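{- Let $(C,\sqsubseteq)$ be a complete lattice, $b\colon C\to C$ a monotone map and $f\in C$. Let $\omega_{b,f}=\bigsqcup\{a\mid a\colon C\to C \text{ monotone and } (b,f)\text{ -compatible}\}$, the least upper bound taken pointwise in the lattice of monotone maps on $C$. Then: (1) $\omega_{b,f}\circ b\sqsubseteq b\circ\omega_{b,f}$; (2) $\omega_{b,f}(f)\sqsubseteq f$; (3) $x\sqsubseteq\omega_{b,f}(x)$ for all $x\in C$; (4) $\omega_{b,f}(\omega_{b,f}(x))\sqsubseteq\omega_{b,f}(x)$ for all $x\in C$.
   Context: A monotone map $a\colon C\to C$ is $(b,f)$-compatible iff $a(f)\sqsubseteq f$ and $a\circ b\sqsubseteq b\circ a$ (pointwise order). -}

module Defs where

open import Level using (Level; _⊔_; suc)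
open import Data.Product using (Σ; _×_)
open import Relation.Binary.Bundles using (Poset)
open import Relation.Binary.Definitions using (Monotonic₁)

record CompleteLattice (c ℓ₁ ℓ₂ : Level) : Set (suc (c ⊔ ℓ₁ ⊔ ℓ₂)) where
  field
    poset : Poset c ℓ₁ ℓ₂
  open Poset poset public
  field
    ⨆        : (Carrier → Set (c ⊔ ℓ₁ ⊔ ℓ₂)) → Carrier
    ⨆-upper  : (S : Carrier → Set (c ⊔ ℓ₁ ⊔ ℓ₂)) → ∀ x → S x → x ≤ ⨆ S
    ⨆-least  : (S : Carrier → Set (c ⊔ ℓ₁ ⊔ ℓ₂)) → ∀ u →
               (∀ x → S x → x ≤ u) → ⨆ S ≤ u

module _ {c ℓ₁ ℓ₂} (L : CompleteLattice c ℓ₁ ℓ₂) where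
  open CompleteLattice L

  Monotone : (Carrier → Carrier) → Set (c ⊔ ℓ₂)
  Monotone a = Monotonic₁ _≤_ _≤_ a

  _⊑ₚ_ : (Carrier → Carrier) → (Carrier → Carrier) → Set (c ⊔ ℓ₂)
  g ⊑ₚ h = ∀ x → g x ≤ h x

  Compatible : (b : Carrier → Carrier) (f : Carrier) → (Carrier → Carrier) → Set (c ⊔ ℓ₂)
  Compatible b f a = (a f ≤ f) × ((λ x → a (b x)) ⊑ₚ (λ x → b (a x)))

  ω : (b : Carrier → Carrier) (f : Carrier) → Carrier → Carrier
  ω b f x = ⨆ (λ y → Σ (Carrier → Carrier) λ a →
                       Monotone a × Compatible b f a × (y ≈ a x))

module Submission where

--   * universal property: every monotone compatible map lies below ω, and
--     ω x ≤ u as soon as a x ≤ u for every monotone compatible a;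
--   * closure: the identity is compatible, and so is a ∘ a′ for compatible
--     a, a′ with a monotone.
--
-- From the universal property, ω is monotone and, when b is monotone,
-- itself compatible (parts (1) and (2)): it is the greatest monotone
-- compatible map.  Part (3) is then "id ≤ ω" and part (4) is "ω ∘ ω ≤ ω",
-- both instances of the upper-bound property via the closure facts.

open import Defs
open import Data.Product using (_×_; _,_; proj₁; proj₂)

module _ {c ℓ₁ ℓ₂} (L : CompleteLattice c ℓ₁ ℓ₂) where
  open CompleteLattice L

  -- Compatible maps form a monoid under composition: the identity is
  -- compatible, and a ∘ a′ is compatible whenever a, a′ are and a is
  -- monotone (a(a′(b x)) ≤ a(b(a′ x)) ≤ b(a(a′ x))).
  id-compatible : ∀ b f → Compatible L b f (λ x → x)
  id-compatible b f = refl , λ _ → refl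

  ∘-compatible : ∀ b f {a a′ : Carrier → Carrier} → Monotone L a →
                 Compatible L b f a → Compatible L b f a′ →
                 Compatible L b f (λ x → a (a′ x))
  ∘-compatible b f a-mono (af≤f , ab≤ba) (a′f≤f , a′b≤ba′) =
      trans (a-mono a′f≤f) af≤f
    , λ x → trans (a-mono (a′b≤ba′ x)) (ab≤ba _)

  module _ (b : Carrier → Carrier) (f : Carrier) where

    ω-upper : ∀ a → Monotone L a → Compatible L b f a → _⊑ₚ_ L a (ω L b f)
    ω-upper a a-mono compat x =
      ⨆-upper _ (a x) (a , (λ {_} {_} → a-mono) , compat , Eq.refl)

    ω-least : ∀ x u →
              (∀ a → Monotone L a → Compatible L b f a → a x ≤ u) →
              ω L b f x ≤ u
    ω-least x u bound = ⨆-least _ u λ { y (a , a-mono , compat , y≈ax) →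
      trans (reflexive y≈ax) (bound a (λ {_} {_} → a-mono) compat) }

    ω-monotone : Monotone L (ω L b f)
    ω-monotone {x} {y} x≤y = ω-least x (ω L b f y) λ a a-mono compat →
      trans (a-mono x≤y) (ω-upper a a-mono compat y)

    -- For monotone b, ω is itself compatible: each compatible a satisfies
    -- a f ≤ f and a (b x) ≤ b (a x) ≤ b (ω x), so the join does too.
    ω-compatible : Monotone L b → Compatible L b f (ω L b f)
    ω-compatible b-mono =
        ω-least f f (λ { a _ (af≤f , _) → af≤f })
      , λ x → ω-least (b x) (b (ω L b f x)) λ { a a-mono (af≤f , ab≤ba) →
          trans (ab≤ba x) (b-mono (ω-upper a a-mono (af≤f , ab≤ba) x)) }

proposition9p8 : ∀ {c ℓ₁ ℓ₂} (L : CompleteLattice c ℓ₁ ℓ₂)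
    (b : CompleteLattice.Carrier L → CompleteLattice.Carrier L)
    (f : CompleteLattice.Carrier L) → Monotone L b →
    (_⊑ₚ_ L (λ x → ω L b f (b x)) (λ x → b (ω L b f x)))
    × CompleteLattice._≤_ L (ω L b f f) f
    × (∀ x → CompleteLattice._≤_ L x (ω L b f x))
    × (∀ x → CompleteLattice._≤_ L (ω L b f (ω L b f x)) (ω L b f x))
proposition9p8 L b f b-mono = ωb≤bω , ωf≤f , id≤ω , ωω≤ω
  where
    open CompleteLattice L

    Ω : Carrier → Carrier
    Ω = ω L b f

    Ω-compatible : Compatible L b f Ω
    Ω-compatible = ω-compatible L b f b-mono

    ωf≤f : Ω f ≤ f
    ωf≤f = proj₁ Ω-compatible

    ωb≤bω : _⊑ₚ_ L (λ x → Ω (b x)) (λ x → b (Ω x))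
    ωb≤bω = proj₂ Ω-compatible

    -- the identity is compatible, hence below ω
    id≤ω : ∀ x → x ≤ Ω x
    id≤ω = ω-upper L b f (λ x → x) (λ x≤y → x≤y) (id-compatible L b f)

    -- ω ∘ ω is compatible, hence below ω
    ωω≤ω : ∀ x → Ω (Ω x) ≤ Ω x
    ωω≤ω = ω-upper L b f (λ x → Ω (Ω x))
             (λ x≤y → ω-monotone L b f (ω-monotone L b f x≤y))
             (∘-compatible L b f (ω-monotone L b f) Ω-compatible Ω-compatible)
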